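{- Let $m\ge 0$ be an integer and $d,s_1,\ldots,s_m$ indeterminates. Then \[ \prod_{i=1}^m\Bigl(d-i+1+\sum_{j=1}^i s_j\Bigr)=\sum_{i=0}^m (d)_i\sum_{\lambda\in L(m,i)}c_m(\lambda)\prod_{j=1}^m (s_j)_{\mathrm{mult}_j(\lambda)}. \]
   Context: $(x)_k=x(x-1)\cdots(x-k+1)$ is the falling factorial, $(x)_0=1$. For integers $m\ge n\ge 0$, $L(m,n)$ is the set of multisets $\lambda=(\lambda(n+1),\lambda(n+2),\ldots,\lambda(m))$ of $m-n$ integers with $1\le\lambda(n+1)\le\lambda(n+2)\le\cdots\le\lambda(m)$ and $\lambda(i)\le i$ for each $n+1\le i\le m$ (so $L(m,m)$ consists of the empty multiset). $\mathrm{mult}_i(\lambda)$ is the number of times $i$ occurs in $\lambda$, and \[ c_m(\lambda)=\prod_{i=1}^m\binom{m-i+1-\sum_{j=i+1}^m\mathrm{mult}_j(\lambda)}{\mathrm{mult}_i(\lambda)}. \] -}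

module Defs where

open import Level using (Level)
open import Data.Nat using (ℕ; zero; suc; _≤_; _∸_; _≟_; _≤?_)
open import Data.Nat.Combinatorics using (_C_)
open import Data.List using (List; []; _∷_; map; concatMap; upTo; filter; length; foldr)
open import Data.List.Relation.Unary.All using (All; all?)
open import Data.List.Relation.Unary.Linked using (Linked; linked?)
open import Data.Product using (_×_)
open import Data.Product.Properties using ()
open import Data.Unit using (⊤; tt)
open import Relation.Nullary using (Dec; yes; no)
open import Relation.Nullary.Decidable using (_×-dec_)
open import Relation.Binary.PropositionalEquality using (_≡_)
open import Algebra.Bundles using (CommutativeRing)

oneTo : ℕ → List ℕ
oneTo m = map suc (upTo m)

allLists : ℕ → ℕ → List (List ℕ)
allLists zero    m = [] ∷ []
allLists (suc k) m = concatMap (λ x → map (x ∷_) (allLists k m)) (oneTo m)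

BoundedFrom : ℕ → List ℕ → Set
BoundedFrom i []       = ⊤
BoundedFrom i (x ∷ xs) = (x ≤ i) × BoundedFrom (suc i) xs

boundedFrom? : ∀ i xs → Dec (BoundedFrom i xs)
boundedFrom? i []       = yes tt
boundedFrom? i (x ∷ xs) = (x ≤? i) ×-dec boundedFrom? (suc i) xs

-- A multiset λ = (λ(n+1) ≤ ... ≤ λ(m)) is represented by its sorted list
-- of elements; IsL m n λ says λ ∈ L(m,n).
IsL : ℕ → ℕ → List ℕ → Set
IsL m n l = (length l ≡ m ∸ n) × Linked _≤_ l × All (1 ≤_) l × BoundedFrom (suc n) l

isL? : ∀ m n l → Dec (IsL m n l)
isL? m n l = (length l ≟ (m ∸ n)) ×-dec (linked? _≤?_ l ×-dec (all? (1 ≤?_) l ×-dec boundedFrom? (suc n) l))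

Lset : ℕ → ℕ → List (List ℕ)
Lset m n = filter (isL? m n) (allLists (m ∸ n) m)

mult : ℕ → List ℕ → ℕ
mult i l = length (filter (i ≟_) l)

sumℕ : List ℕ → ℕ
sumℕ = foldr Data.Nat._+_ 0

prodℕ : List ℕ → ℕ
prodℕ = foldr Data.Nat._*_ 1

multAbove : ℕ → ℕ → List ℕ → ℕ
multAbove m i l = sumℕ (map (λ j → mult j l) (map (λ k → suc i Data.Nat.+ k) (upTo (m ∸ i))))

cm : ℕ → List ℕ → ℕ
cm m l = prodℕ (map (λ i → ((m ∸ i Data.Nat.+ 1) ∸ multAbove m i l) C mult i l) (oneTo m))

module RingDefs {c ℓ : Level} (R : CommutativeRing c ℓ) where
  open CommutativeRing R

  fromℕ : ℕ → Carrier
  fromℕ zero    = 0#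
  fromℕ (suc n) = 1# + fromℕ n

  ff : Carrier → ℕ → Carrier
  ff x zero    = 1#
  ff x (suc k) = ff x k * (x - fromℕ k)

  ΣR : List Carrier → Carrier
  ΣR = foldr _+_ 0#

  ΠR : List Carrier → Carrier
  ΠR = foldr _*_ 1#

  lhs : ℕ → Carrier → (ℕ → Carrier) → Carrier
  lhs m d s = ΠR (map (λ i → (d - fromℕ (i ∸ 1)) + ΣR (map s (oneTo i))) (oneTo m))

  rhs : ℕ → Carrier → (ℕ → Carrier) → Carrier
  rhs m d s = ΣR (map (λ i → ff d i *
                 ΣR (map (λ l → fromℕ (cm m l) * ΠR (map (λ j → ff (s j) (mult j l)) (oneTo m)))
                         (Lset m i)))
                 (upTo (suc m)))

-- Sort λ and sum out its entries from the largest value downwards. Fix the block t of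
-- entries of λ exceeding i, occupying positions i + r + 1, …, m. The factors of
-- c_m(λ) ∏_j (s_j)_{mult_j(λ)} with j > i depend on t alone, and summing the rest of the
-- right-hand side over all sorted choices of the remaining entries gives
--   ∏_{j ≤ i} (d − j + 1 + s_1 + ⋯ + s_j) · (X_i)_r,   where X_i = d + s_1 + ⋯ + s_i − i.
-- For i = 0 this is the factor (d)_r. From i to i + 1 one sums over the multiplicity a of
-- the value i + 1: the condition λ(k) ≤ k forces a ≤ r + 1, the factor of c_m(λ) at i + 1
-- is then C(r + 1, a), and Chu–Vandermonde gives
--   Σ_a C(r + 1, a) (s_{i+1})_a (X_i)_{r+1−a} = (X_i + s_{i+1})_{r+1} = (X_i + s_{i+1}) (X_{i+1})_r,
-- where X_i + s_{i+1} is the (i + 1)-st factor of the left-hand side. The case i = m, r = 0,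
-- t = [] is the identity.

module Submission where
open import Defs
open import Level using (Level)
open import Algebra.Bundles using (CommutativeRing)
open import Data.Nat as N using (ℕ; zero; suc; _∸_; _≤_; _<_; z≤n; s≤s)
import Data.Nat.Properties as ℕₚ
open import Data.Nat.Combinatorics using (_C_; k>n⇒nCk≡0; nCk+nC[k+1]≡[n+1]C[k+1])
open import Data.List using (List; []; _∷_; [_]; _++_; map; concatMap; upTo; applyUpTo; length; filter; replicate)
import Data.List.Properties as Listₚ
open import Data.List.Relation.Unary.All as All using (All; []; _∷_)
import Data.List.Relation.Unary.All.Properties as Allₚ
open import Data.List.Relation.Unary.Linked as Linked using (Linked; [-]; _∷_; [])
open import Data.Sum using (inj₁; inj₂)
open import Data.Product using (_×_; _,_; proj₁; proj₂)
open import Data.Unit using (⊤; tt)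
open import Data.Empty using (⊥-elim)
open import Function using (_∘_)
open import Data.Nat.Tactic.RingSolver using (solve-∀)
open import Relation.Nullary using (Dec; yes; no; ¬_)
open import Relation.Nullary.Decidable using (_×-dec_)
import Relation.Binary.PropositionalEquality as ≡
open ≡ using (_≡_; _≢_)

range : ℕ → ℕ → List ℕ
range lo zero    = []
range lo (suc c) = lo ∷ range (suc lo) c

multIn : ℕ → ℕ → List ℕ → ℕ
multIn lo c t = sumℕ (map (λ j → mult j t) (range lo c))

SortedWithin : ℕ → ℕ → List ℕ → Set
SortedWithin lo hi []      = ⊤
SortedWithin lo hi (x ∷ l) = lo ≤ x × x ≤ hi × SortedWithin x hi l

sortedWithin? : ∀ lo hi l → Dec (SortedWithin lo hi l)
sortedWithin? lo hi []      = yes tt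
sortedWithin? lo hi (x ∷ l) = (lo N.≤? x) ×-dec ((x N.≤? hi) ×-dec sortedWithin? x hi l)

replicate-∷ʳ : ∀ {a} {A : Set a} n (x : A) → replicate n x ++ [ x ] ≡ x ∷ replicate n x
replicate-∷ʳ zero    x = ≡.refl
replicate-∷ʳ (suc n) x = ≡.cong (x ∷_) (replicate-∷ʳ n x)

module _ where
  open N using (_+_)
  open ℕₚ

  applyUpTo≡range : ∀ {f : ℕ → ℕ} lo c → (∀ k → f k ≡ lo + k) → applyUpTo f c ≡ range lo c
  applyUpTo≡range lo zero    f≗ = ≡.refl
  applyUpTo≡range lo (suc c) f≗ = ≡.cong₂ _∷_ (≡.trans (f≗ 0) (+-identityʳ lo))
    (applyUpTo≡range (suc lo) c (λ k → ≡.trans (f≗ (suc k)) (+-suc lo k)))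

  oneTo≡range : ∀ m → oneTo m ≡ range 1 m
  oneTo≡range m = ≡.trans (Listₚ.map-upTo suc m) (applyUpTo≡range 1 m (λ _ → ≡.refl))

  oneTo-∷ʳ : ∀ i → oneTo (suc i) ≡ oneTo i ++ [ suc i ]
  oneTo-∷ʳ i = ≡.trans (≡.cong (map suc) (≡.sym (Listₚ.upTo-∷ʳ i))) (Listₚ.map-++ suc (upTo i) [ i ])

  multAbove≡multIn : ∀ m i l → multAbove m i l ≡ multIn (suc i) (m ∸ i) l
  multAbove≡multIn m i l = ≡.cong (λ js → sumℕ (map (λ j → mult j l) js))
    (≡.trans (Listₚ.map-upTo (suc i +_) (m ∸ i)) (applyUpTo≡range (suc i) (m ∸ i) (λ _ → ≡.refl)))

  All-range : ∀ {p} {P : ℕ → Set p} lo c → (∀ j → lo ≤ j → j < lo + c → P j) → All P (range lo c)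
  All-range lo zero    h = []
  All-range lo (suc c) h = h lo ≤-refl (≡.subst (lo <_) (≡.sym (+-suc lo c)) (s≤s (m≤m+n lo c)))
    ∷ All-range (suc lo) c (λ j lo<j j<hi → h j (<⇒≤ lo<j) (≡.subst (j <_) (≡.sym (+-suc lo c)) j<hi))

  mult-head : ∀ x l → mult x (x ∷ l) ≡ suc (mult x l)
  mult-head x l = ≡.cong length (Listₚ.filter-accept (x N.≟_) {x} {l} ≡.refl)

  mult-≢ : ∀ {j x} l → j ≢ x → mult j (x ∷ l) ≡ mult j l
  mult-≢ {j} {x} l j≢x = ≡.cong length (Listₚ.filter-reject (j N.≟_) {x} {l} j≢x)

  mult-replicate : ∀ x a t → mult x (replicate a x ++ t) ≡ a + mult x t
  mult-replicate x zero    t = ≡.refl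
  mult-replicate x (suc a) t = ≡.trans (mult-head x (replicate a x ++ t)) (≡.cong suc (mult-replicate x a t))

  mult-replicate-≢ : ∀ {j x} a t → j ≢ x → mult j (replicate a x ++ t) ≡ mult j t
  mult-replicate-≢ zero    t j≢x = ≡.refl
  mult-replicate-≢ (suc a) t j≢x = ≡.trans (mult-≢ _ j≢x) (mult-replicate-≢ a t j≢x)

  mult-absent : ∀ j t → All (j <_) t → mult j t ≡ 0
  mult-absent j []      []            = ≡.refl
  mult-absent j (x ∷ t) (j<x ∷ j<t) = ≡.trans (mult-≢ t (<⇒≢ j<x)) (mult-absent j t j<t)

  multIn-∷-below : ∀ lo c {x} t → x < lo → multIn lo c (x ∷ t) ≡ multIn lo c t
  multIn-∷-below lo zero    t x<lo = ≡.refl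
  multIn-∷-below lo (suc c) t x<lo =
    ≡.cong₂ _+_ (mult-≢ t (>⇒≢ x<lo)) (multIn-∷-below (suc lo) c t (m≤n⇒m≤1+n x<lo))

  multIn-∷-within : ∀ lo c {x} t → lo ≤ x → x < lo + c → multIn lo c (x ∷ t) ≡ suc (multIn lo c t)
  multIn-∷-within lo zero    t lo≤x x<lo+0 = ⊥-elim (<⇒≱ (≡.subst (_ <_) (+-identityʳ lo) x<lo+0) lo≤x)
  multIn-∷-within lo (suc c) {x} t lo≤x x<hi with lo N.≟ x
  ... | yes ≡.refl = ≡.cong₂ _+_ (mult-head lo t) (multIn-∷-below (suc lo) c t ≤-refl)
  ... | no lo≢x    = ≡.trans
    (≡.cong₂ _+_ (mult-≢ t lo≢x) (multIn-∷-within (suc lo) c t (≤∧≢⇒< lo≤x lo≢x) (≡.subst (x <_) (+-suc lo c) x<hi)))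
    (+-suc (mult lo t) (multIn (suc lo) c t))

  multIn≡length : ∀ lo c t → All (λ x → lo ≤ x × x < lo + c) t → multIn lo c t ≡ length t
  multIn≡length lo zero    []      []                    = ≡.refl
  multIn≡length lo (suc c) []      []                    = multIn≡length (suc lo) c [] []
  multIn≡length lo c       (x ∷ t) ((lo≤x , x<hi) ∷ ts) =
    ≡.trans (multIn-∷-within lo c t lo≤x x<hi) (≡.cong suc (multIn≡length lo c t ts))

  multIn-replicate-below : ∀ lo c {x} a t → x < lo → multIn lo c (replicate a x ++ t) ≡ multIn lo c t
  multIn-replicate-below lo c zero    t x<lo = ≡.refl
  multIn-replicate-below lo c (suc a) t x<lo =
    ≡.trans (multIn-∷-below lo c _ x<lo) (multIn-replicate-below lo c a t x<lo)

  BoundedFrom-++⁻ : ∀ p l t → BoundedFrom p (l ++ t) → BoundedFrom (p + length l) t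
  BoundedFrom-++⁻ p []      t b       = ≡.subst (λ q → BoundedFrom q t) (≡.sym (+-identityʳ p)) b
  BoundedFrom-++⁻ p (x ∷ l) t (_ , b) =
    ≡.subst (λ q → BoundedFrom q t) (≡.sym (+-suc p (length l))) (BoundedFrom-++⁻ (suc p) l t b)

  BoundedFrom-replicate⁺ : ∀ p a {x} t → x ≤ p → BoundedFrom (p + a) t → BoundedFrom p (replicate a x ++ t)
  BoundedFrom-replicate⁺ p zero    t x≤p b = ≡.subst (λ q → BoundedFrom q t) (+-identityʳ p) b
  BoundedFrom-replicate⁺ p (suc a) t x≤p b =
    x≤p , BoundedFrom-replicate⁺ (suc p) a t (m≤n⇒m≤1+n x≤p) (≡.subst (λ q → BoundedFrom q t) (+-suc p a) b)

  SortedWithin-∷ʳ⁻ : ∀ lo hi l y → SortedWithin lo hi (l ++ [ y ]) → SortedWithin lo y l × lo ≤ y × y ≤ hi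
  SortedWithin-∷ʳ⁻ lo hi []      y (lo≤y , y≤hi , _) = tt , lo≤y , y≤hi
  SortedWithin-∷ʳ⁻ lo hi (x ∷ l) y (lo≤x , _ , s) with SortedWithin-∷ʳ⁻ x hi l y s
  ... | s′ , x≤y , y≤hi = (lo≤x , x≤y , s′) , ≤-trans lo≤x x≤y , y≤hi

  SortedWithin-∷ʳ⁺ : ∀ lo hi l y → SortedWithin lo y l → lo ≤ y → y ≤ hi → SortedWithin lo hi (l ++ [ y ])
  SortedWithin-∷ʳ⁺ lo hi []      y _                  lo≤y y≤hi = lo≤y , y≤hi , tt
  SortedWithin-∷ʳ⁺ lo hi (x ∷ l) y (lo≤x , x≤y , s) lo≤y y≤hi =
    lo≤x , ≤-trans x≤y y≤hi , SortedWithin-∷ʳ⁺ x hi l y s x≤y y≤hi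

  SortedWithin⇒Linked : ∀ lo hi l → SortedWithin lo hi l → Linked _≤_ (lo ∷ l)
  SortedWithin⇒Linked lo hi []      _                 = [-]
  SortedWithin⇒Linked lo hi (x ∷ l) (lo≤x , _ , s) = lo≤x ∷ SortedWithin⇒Linked x hi l s

  SortedWithin⇒≥ : ∀ lo hi l → SortedWithin lo hi l → All (lo ≤_) l
  SortedWithin⇒≥ lo hi []      _                 = []
  SortedWithin⇒≥ lo hi (x ∷ l) (lo≤x , _ , s) = lo≤x ∷ All.map (≤-trans lo≤x) (SortedWithin⇒≥ x hi l s)

  Linked-∷⁺ : ∀ {lo l} → All (lo ≤_) l → Linked _≤_ l → Linked _≤_ (lo ∷ l)
  Linked-∷⁺ []           _   = [-]
  Linked-∷⁺ (lo≤x ∷ _) lnk = lo≤x ∷ lnk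

  Linked⇒SortedWithin : ∀ lo hi l → Linked _≤_ (lo ∷ l) → All (_≤ hi) l → SortedWithin lo hi l
  Linked⇒SortedWithin lo hi []      _              _             = tt
  Linked⇒SortedWithin lo hi (x ∷ l) (lo≤x ∷ lnk) (x≤hi ∷ l≤hi) = lo≤x , x≤hi , Linked⇒SortedWithin x hi l lnk l≤hi

  length-replicate-++ : ∀ a {x : ℕ} t → length (replicate a x ++ t) ≡ a + length t
  length-replicate-++ a t = ≡.trans (Listₚ.length-++ (replicate a _)) (≡.cong (_+ length t) (Listₚ.length-replicate a))

  +-regroup : ∀ i b a t → i + b + (a + t) ≡ i + (b + a) + t
  +-regroup = solve-∀

  ∸-binomialTop : ∀ i r t → (suc i + r + t ∸ suc i + 1) ∸ t ≡ suc r
  ∸-binomialTop i r t = begin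
    (suc i + r + t ∸ suc i + 1) ∸ t    ≡⟨ ≡.cong (λ k → (k ∸ suc i + 1) ∸ t) (+-assoc (suc i) r t) ⟩
    (suc i + (r + t) ∸ suc i + 1) ∸ t  ≡⟨ ≡.cong (λ k → (k + 1) ∸ t) (m+n∸m≡n (suc i) (r + t)) ⟩
    (r + t + 1) ∸ t                    ≡⟨ ≡.cong (_∸ t) (+-suc-comm r t) ⟩
    (t + suc r) ∸ t                    ≡⟨ m+n∸m≡n t (suc r) ⟩
    suc r                              ∎
    where
    open ≡.≡-Reasoning
    +-suc-comm : ∀ r t → r + t + 1 ≡ t + suc r
    +-suc-comm = solve-∀

  multiplicity-bound : ∀ {i r a q} → suc i ≤ suc q → q + a ≡ suc i + r → a ≤ suc r
  multiplicity-bound {i} {r} {a} {q} i≤q q+a≡ = +-cancelˡ-≤ (suc i) a (suc r) (begin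
    suc i + a    ≤⟨ +-monoˡ-≤ a i≤q ⟩
    suc (q + a)  ≡⟨ ≡.cong suc q+a≡ ⟩
    suc (suc i + r) ≡⟨ +-suc (suc i) r ⟨
    suc i + suc r ∎)
    where open ≤-Reasoning

module Tails (m : ℕ) where
  open N using (_+_)
  open ℕₚ

  -- t is a block of entries > i ending λ, at positions i + r + 1, …, m, where λ(k) ≤ k holds.
  record Tail (i r : ℕ) (t : List ℕ) : Set where
    field
      length-≡ : i + r + length t ≡ m
      bounded  : BoundedFrom (suc (i + r)) t
      above    : All (λ x → i < x × x ≤ m) t

  Tail-[] : Tail m 0 []
  Tail-[] = record { length-≡ = ≡.trans (+-identityʳ (m + 0)) (+-identityʳ m) ; bounded = tt ; above = [] }

  Tail⇒i≤m : ∀ {i r t} → Tail i r t → i ≤ m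
  Tail⇒i≤m {i} {r} {t} tail = ≡.subst (i ≤_) (Tail.length-≡ tail) (≤-trans (m≤m+n i r) (m≤m+n (i + r) (length t)))

  Tail-replicate : ∀ {i r t a} → Tail (suc i) r t → a ≤ suc r → Tail i (suc r ∸ a) (replicate a (suc i) ++ t)
  Tail-replicate {i} {r} {t} {a} tail a≤1+r = record
    { length-≡ = begin
        i + b + length (replicate a (suc i) ++ t)  ≡⟨ ≡.cong (i + b +_) (length-replicate-++ a t) ⟩
        i + b + (a + length t)                     ≡⟨ +-regroup i b a (length t) ⟩
        i + (b + a) + length t                     ≡⟨ ≡.cong (λ k → i + k + length t) b+a≡1+r ⟩
        i + suc r + length t                       ≡⟨ ≡.cong (_+ length t) (+-suc i r) ⟩
        suc i + r + length t                       ≡⟨ length-≡ ⟩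
        m                                          ∎
    ; bounded  = BoundedFrom-replicate⁺ (suc (i + b)) a t (s≤s (m≤m+n i b))
                   (≡.subst (λ p → BoundedFrom p t) (≡.cong suc i+r≡i+b+a) bounded)
    ; above    = Allₚ.++⁺ (Allₚ.replicate⁺ a (≤-refl , Tail⇒i≤m tail)) (All.map (λ (i<x , x≤m) → <⇒≤ i<x , x≤m) above)
    }
    where
    open Tail tail
    open ≡.≡-Reasoning
    b : ℕ
    b = suc r ∸ a
    b+a≡1+r : b + a ≡ suc r
    b+a≡1+r = m∸n+n≡m a≤1+r
    i+r≡i+b+a : suc (i + r) ≡ i + b + a
    i+r≡i+b+a = ≡.sym (≡.trans (+-assoc i b a) (≡.trans (≡.cong (i +_) b+a≡1+r) (+-suc i r)))

  -- More than r + 1 copies of i + 1 in front of t put the first of them before position i + 1.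
  Tail-overfull : ∀ {i r t} l a → Tail (suc i) r t → suc r < a → length l + a ≤ suc i + r →
                  ¬ BoundedFrom (suc (m ∸ length (l ++ replicate a (suc i) ++ t))) (l ++ replicate a (suc i) ++ t)
  Tail-overfull l zero tail () fits
  Tail-overfull {i} {r} {t} l (suc a) tail r<a fits b = <⇒≱ r<a (multiplicity-bound first sums)
    where
    open Tail tail
    open ≡.≡-Reasoning
    u : List ℕ
    u = l ++ replicate (suc a) (suc i) ++ t
    M : ℕ
    M = m ∸ length u
    length-u : length u ≡ length l + suc a + length t
    length-u = begin
      length u                                          ≡⟨ Listₚ.length-++ l ⟩
      length l + length (replicate (suc a) (suc i) ++ t) ≡⟨ ≡.cong (length l +_) (length-replicate-++ (suc a) t) ⟩
      length l + (suc a + length t)                     ≡⟨ +-assoc (length l) (suc a) (length t) ⟨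
      length l + suc a + length t                       ∎
    u≤m : length u ≤ m
    u≤m = ≡.subst₂ _≤_ (≡.sym length-u) length-≡ (+-monoˡ-≤ (length t) fits)
    first : suc i ≤ suc (M + length l)
    first = proj₁ (BoundedFrom-++⁻ (suc M) l _ b)
    sums : M + length l + suc a ≡ suc i + r
    sums = +-cancelʳ-≡ (length t) _ _ (begin
      M + length l + suc a + length t     ≡⟨ +-assoc³ M (length l) (suc a) (length t) ⟩
      M + (length l + suc a + length t)   ≡⟨ ≡.cong (M +_) length-u ⟨
      M + length u                        ≡⟨ m∸n+n≡m u≤m ⟩
      m                                   ≡⟨ length-≡ ⟨
      suc i + r + length t                ∎)
      where
      +-assoc³ : ∀ w x y z → w + x + y + z ≡ w + (x + y + z)
      +-assoc³ = solve-∀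

module RingSums {c ℓ : Level} (R : CommutativeRing c ℓ) where
  open CommutativeRing R
  open RingDefs R
  open import Algebra.Properties.AbelianGroup +-abelianGroup using (⁻¹-∙-comm; ε⁻¹≈ε)
  open import Algebra.Solver.Ring.NaturalCoefficients.Default commutativeSemiring using (solve; _:+_; _:*_; _:=_)
  open import Relation.Binary.Reasoning.Setoid setoid

  -‿distrib-+ : ∀ x y → - (x + y) ≈ - x + - y
  -‿distrib-+ x y = sym (⁻¹-∙-comm x y)

  +-interchange : ∀ w x y z → (w + x) + (y + z) ≈ (w + y) + (x + z)
  +-interchange = solve 4 (λ w x y z → (w :+ x) :+ (y :+ z) := (w :+ y) :+ (x :+ z)) refl

  infixr 8 [_]ᵈ_
  [_]ᵈ_ : ∀ {p} {Q : Set p} → Dec Q → Carrier → Carrier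
  [ yes _ ]ᵈ x = x
  [ no  _ ]ᵈ x = 0#

  [yes]ᵈ : ∀ {p} {Q : Set p} (q? : Dec Q) {x} → Q → [ q? ]ᵈ x ≈ x
  [yes]ᵈ (yes _) q = refl
  [yes]ᵈ (no ¬q) q = ⊥-elim (¬q q)

  [no]ᵈ : ∀ {p} {Q : Set p} (q? : Dec Q) {x} → ¬ Q → [ q? ]ᵈ x ≈ 0#
  [no]ᵈ (yes q) ¬q = ⊥-elim (¬q q)
  [no]ᵈ (no _)  ¬q = refl

  [⇔]ᵈ : ∀ {p q} {Q : Set p} {Q′ : Set q} (q? : Dec Q) (q′? : Dec Q′) {x} → (Q → Q′) → (Q′ → Q) → [ q? ]ᵈ x ≈ [ q′? ]ᵈ x
  [⇔]ᵈ (yes q) q′? to from = sym ([yes]ᵈ q′? (to q))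
  [⇔]ᵈ (no ¬q) q′? to from = sym ([no]ᵈ q′? (¬q ∘ from))

  [×]ᵈ : ∀ {p q r} {Q : Set p} {A : Set q} {B : Set r} (q? : Dec Q) (a? : Dec A) (b? : Dec B) {x} →
         (Q → A × B) → (A → B → Q) → [ q? ]ᵈ x ≈ [ a? ]ᵈ [ b? ]ᵈ x
  [×]ᵈ q? (yes a) (yes b) to from = [yes]ᵈ q? (from a b)
  [×]ᵈ q? (yes a) (no ¬b) to from = [no]ᵈ q? (¬b ∘ proj₂ ∘ to)
  [×]ᵈ q? (no ¬a) b?      to from = [no]ᵈ q? (¬a ∘ proj₁ ∘ to)

  [_]ᵈ-zero : ∀ {p} {Q : Set p} (q? : Dec Q) {x} → x ≈ 0# → [ q? ]ᵈ x ≈ 0#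
  [ yes _ ]ᵈ-zero x≈0 = x≈0
  [ no  _ ]ᵈ-zero x≈0 = refl

  [_]ᵈ-*ˡ : ∀ {p} {Q : Set p} (q? : Dec Q) {y x} → y * [ q? ]ᵈ x ≈ [ q? ]ᵈ (y * x)
  [ yes _ ]ᵈ-*ˡ = refl
  [ no  _ ]ᵈ-*ˡ = zeroʳ _

  sumMap : ∀ {a} {A : Set a} → (A → Carrier) → List A → Carrier
  sumMap f xs = ΣR (map f xs)

  infixr 8 sumMap
  syntax sumMap (λ x → e) xs = ∑[ x ∈ xs ] e

  module _ {a} {A : Set a} where

    sumMap-cong : ∀ {f g : A → Carrier} xs → (∀ x → f x ≈ g x) → sumMap f xs ≈ sumMap g xs
    sumMap-cong []       f≈g = refl
    sumMap-cong (x ∷ xs) f≈g = +-cong (f≈g x) (sumMap-cong xs f≈g)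

    sumMap-congᴬ : ∀ {p} {P : A → Set p} {f g : A → Carrier} {xs} → All P xs → (∀ x → P x → f x ≈ g x) → sumMap f xs ≈ sumMap g xs
    sumMap-congᴬ []         f≈g = refl
    sumMap-congᴬ (px ∷ pxs) f≈g = +-cong (f≈g _ px) (sumMap-congᴬ pxs f≈g)

    sumMap-zero : ∀ {f : A → Carrier} xs → (∀ x → f x ≈ 0#) → sumMap f xs ≈ 0#
    sumMap-zero []       f≈0 = refl
    sumMap-zero (x ∷ xs) f≈0 = trans (+-cong (f≈0 x) (sumMap-zero xs f≈0)) (+-identityˡ _)

    sumMap-++ : ∀ (f : A → Carrier) xs ys → sumMap f (xs ++ ys) ≈ sumMap f xs + sumMap f ys
    sumMap-++ f []       ys = sym (+-identityˡ _)
    sumMap-++ f (x ∷ xs) ys = trans (+-cong refl (sumMap-++ f xs ys)) (sym (+-assoc _ _ _))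

    sumMap-+ : ∀ (f g : A → Carrier) xs → ∑[ x ∈ xs ] (f x + g x) ≈ sumMap f xs + sumMap g xs
    sumMap-+ f g []       = sym (+-identityˡ _)
    sumMap-+ f g (x ∷ xs) = trans (+-cong refl (sumMap-+ f g xs)) (+-interchange _ _ _ _)

    sumMap-*ˡ : ∀ y (f : A → Carrier) xs → y * sumMap f xs ≈ ∑[ x ∈ xs ] (y * f x)
    sumMap-*ˡ y f []       = zeroʳ y
    sumMap-*ˡ y f (x ∷ xs) = trans (distribˡ y _ _) (+-cong refl (sumMap-*ˡ y f xs))

    sumMap-filter : ∀ {p} {Q : A → Set p} (q? : ∀ x → Dec (Q x)) (f : A → Carrier) xs →
                    sumMap f (filter q? xs) ≈ ∑[ x ∈ xs ] [ q? x ]ᵈ f x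
    sumMap-filter q? f []       = refl
    sumMap-filter q? f (x ∷ xs) with q? x
    ... | yes _ = +-cong refl (sumMap-filter q? f xs)
    ... | no  _ = trans (sumMap-filter q? f xs) (sym (+-identityˡ _))

  module _ {a b} {A : Set a} {B : Set b} where

    sumMap-map : ∀ (f : B → Carrier) (g : A → B) xs → sumMap f (map g xs) ≡ sumMap (f ∘ g) xs
    sumMap-map f g xs = ≡.cong ΣR (≡.sym (Listₚ.map-∘ xs))

    sumMap-concatMap : ∀ (f : B → Carrier) (g : A → List B) xs → sumMap f (concatMap g xs) ≈ ∑[ x ∈ xs ] sumMap f (g x)
    sumMap-concatMap f g []       = refl
    sumMap-concatMap f g (x ∷ xs) = trans (sumMap-++ f (g x) (concatMap g xs)) (+-cong refl (sumMap-concatMap f g xs))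

  sumTo : ℕ → (ℕ → Carrier) → Carrier
  sumTo zero    f = f 0
  sumTo (suc n) f = sumTo n f + f (suc n)

  infixr 8 sumTo
  syntax sumTo n (λ a → e) = ∑[ a ≤ n ] e

  sumTo-suc : ∀ n f → sumTo (suc n) f ≈ f 0 + ∑[ a ≤ n ] f (suc a)
  sumTo-suc zero    f = refl
  sumTo-suc (suc n) f = trans (+-cong (sumTo-suc n f) refl) (+-assoc _ _ _)

  sumTo-cong : ∀ {f g} n → (∀ a → a ≤ n → f a ≈ g a) → sumTo n f ≈ sumTo n g
  sumTo-cong zero    f≈g = f≈g 0 z≤n
  sumTo-cong (suc n) f≈g = +-cong (sumTo-cong n (λ a a≤n → f≈g a (ℕₚ.m≤n⇒m≤1+n a≤n))) (f≈g (suc n) ℕₚ.≤-refl)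

  sumTo-zero : ∀ {f} n → (∀ a → a ≤ n → f a ≈ 0#) → sumTo n f ≈ 0#
  sumTo-zero zero    f≈0 = f≈0 0 z≤n
  sumTo-zero (suc n) f≈0 =
    trans (+-cong (sumTo-zero n (λ a a≤n → f≈0 a (ℕₚ.m≤n⇒m≤1+n a≤n))) (f≈0 (suc n) ℕₚ.≤-refl)) (+-identityˡ _)

  sumTo-+ : ∀ f g n → ∑[ a ≤ n ] (f a + g a) ≈ sumTo n f + sumTo n g
  sumTo-+ f g zero    = refl
  sumTo-+ f g (suc n) = trans (+-cong (sumTo-+ f g n) refl) (+-interchange _ _ _ _)

  sumTo-*ˡ : ∀ y f n → y * sumTo n f ≈ ∑[ a ≤ n ] (y * f a)
  sumTo-*ˡ y f zero    = refl
  sumTo-*ˡ y f (suc n) = trans (distribˡ y _ _) (+-cong (sumTo-*ˡ y f n) refl)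

  sumTo-*ʳ : ∀ y f n → sumTo n f * y ≈ ∑[ a ≤ n ] (f a * y)
  sumTo-*ʳ y f n = trans (*-comm _ y) (trans (sumTo-*ˡ y f n) (sumTo-cong n (λ a _ → *-comm y (f a))))

  sumTo-truncate : ∀ f {m n} → m ≤ n → (∀ a → m < a → a ≤ n → f a ≈ 0#) → sumTo n f ≈ sumTo m f
  sumTo-truncate f {m} {zero}  z≤n  f≈0 = refl
  sumTo-truncate f {m} {suc n} m≤1+n f≈0 with ℕₚ.m≤n⇒m<n∨m≡n m≤1+n
  ... | inj₂ ≡.refl = refl
  ... | inj₁ (s≤s m≤n) = trans
    (+-cong (sumTo-truncate f m≤n (λ a m<a a≤n → f≈0 a m<a (ℕₚ.m≤n⇒m≤1+n a≤n))) (f≈0 (suc n) (s≤s m≤n) ℕₚ.≤-refl))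
    (+-identityʳ _)

  sumTo-reverse : ∀ f n → ∑[ a ≤ n ] f (n ∸ a) ≈ sumTo n f
  sumTo-reverse f zero    = refl
  sumTo-reverse f (suc n) = begin
    ∑[ a ≤ suc n ] f (suc n ∸ a)         ≈⟨ sumTo-suc n _ ⟩
    f (suc n) + ∑[ a ≤ n ] f (n ∸ a)     ≈⟨ +-cong refl (sumTo-reverse f n) ⟩
    f (suc n) + sumTo n f                ≈⟨ +-comm _ _ ⟩
    sumTo (suc n) f                      ∎

  sumTo-triangle : ∀ (f : ℕ → ℕ → Carrier) n → ∑[ k ≤ n ] ∑[ a ≤ k ] f a (k ∸ a) ≈ ∑[ a ≤ n ] ∑[ b ≤ n ∸ a ] f a b
  sumTo-triangle f zero    = refl
  sumTo-triangle f (suc n) = begin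
    ∑[ k ≤ n ] ∑[ a ≤ k ] f a (k ∸ a) + (∑[ a ≤ n ] f a (suc n ∸ a) + f (suc n) (n ∸ n))
      ≈⟨ +-cong (sumTo-triangle f n) refl ⟩
    ∑[ a ≤ n ] ∑[ b ≤ n ∸ a ] f a b + (∑[ a ≤ n ] f a (suc n ∸ a) + f (suc n) (n ∸ n))
      ≈⟨ sym (+-assoc _ _ _) ⟩
    (∑[ a ≤ n ] ∑[ b ≤ n ∸ a ] f a b + ∑[ a ≤ n ] f a (suc n ∸ a)) + f (suc n) (n ∸ n)
      ≈⟨ +-cong (sym (sumTo-+ _ _ n)) (reflexive (≡.cong (f (suc n)) (ℕₚ.n∸n≡0 n))) ⟩
    ∑[ a ≤ n ] (∑[ b ≤ n ∸ a ] f a b + f a (suc n ∸ a)) + f (suc n) 0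
      ≈⟨ +-cong (sumTo-cong n extend) (reflexive (≡.cong (λ k → sumTo k (f (suc n))) (≡.sym (ℕₚ.n∸n≡0 n)))) ⟩
    ∑[ a ≤ n ] ∑[ b ≤ suc n ∸ a ] f a b + ∑[ b ≤ n ∸ n ] f (suc n) b ∎
    where
    extend : ∀ a → a ≤ n → ∑[ b ≤ n ∸ a ] f a b + f a (suc n ∸ a) ≈ ∑[ b ≤ suc n ∸ a ] f a b
    extend a a≤n rewrite ℕₚ.+-∸-assoc 1 a≤n = refl

  sumMap-applyUpTo : ∀ (f : ℕ → Carrier) g n → sumMap f (applyUpTo g (suc n)) ≈ ∑[ a ≤ n ] f (g a)
  sumMap-applyUpTo f g zero    = +-identityʳ _
  sumMap-applyUpTo f g (suc n) = trans (+-cong refl (sumMap-applyUpTo f (g ∘ suc) n)) (sym (sumTo-suc n (f ∘ g)))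

  fromℕ-+ : ∀ a b → fromℕ (a N.+ b) ≈ fromℕ a + fromℕ b
  fromℕ-+ zero    b = sym (+-identityˡ _)
  fromℕ-+ (suc a) b = trans (+-cong refl (fromℕ-+ a b)) (sym (+-assoc _ _ _))

  fromℕ-* : ∀ a b → fromℕ (a N.* b) ≈ fromℕ a * fromℕ b
  fromℕ-* zero    b = sym (zeroˡ _)
  fromℕ-* (suc a) b = begin
    fromℕ (b N.+ a N.* b)               ≈⟨ fromℕ-+ b (a N.* b) ⟩
    fromℕ b + fromℕ (a N.* b)           ≈⟨ +-cong (sym (*-identityˡ _)) (fromℕ-* a b) ⟩
    1# * fromℕ b + fromℕ a * fromℕ b   ≈⟨ sym (distribʳ _ _ _) ⟩
    (1# + fromℕ a) * fromℕ b           ∎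

  ff-cong : ∀ {x y} k → x ≈ y → ff x k ≈ ff y k
  ff-cong zero    x≈y = refl
  ff-cong (suc k) x≈y = *-cong (ff-cong k x≈y) (+-cong x≈y refl)

  ff-suc : ∀ x r → ff x (suc r) ≈ x * ff (x - 1#) r
  ff-suc x zero = begin
    1# * (x - 0#)   ≈⟨ *-identityˡ _ ⟩
    x - 0#          ≈⟨ +-cong refl ε⁻¹≈ε ⟩
    x + 0#          ≈⟨ +-identityʳ x ⟩
    x               ≈⟨ sym (*-identityʳ x) ⟩
    x * 1#          ∎
  ff-suc x (suc r) = begin
    ff x (suc r) * (x - (1# + fromℕ r))             ≈⟨ *-cong (ff-suc x r) (+-cong refl (-‿distrib-+ _ _)) ⟩
    x * ff (x - 1#) r * (x + (- 1# + - fromℕ r))    ≈⟨ *-assoc _ _ _ ⟩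
    x * (ff (x - 1#) r * (x + (- 1# + - fromℕ r)))  ≈⟨ *-cong refl (*-cong refl (sym (+-assoc _ _ _))) ⟩
    x * (ff (x - 1#) r * ((x - 1#) - fromℕ r))      ∎

  -fromℕ-∸ : ∀ x y {a n} → a ≤ n → (y - fromℕ a) + (x - fromℕ (n ∸ a)) ≈ (x + y) - fromℕ n
  -fromℕ-∸ x y {a} {n} a≤n = begin
    (y - fromℕ a) + (x - fromℕ (n ∸ a))        ≈⟨ +-interchange y _ x _ ⟩
    (y + x) + (- fromℕ a + - fromℕ (n ∸ a))    ≈⟨ +-cong (+-comm y x) (sym (-‿distrib-+ _ _)) ⟩
    (x + y) - (fromℕ a + fromℕ (n ∸ a))        ≈⟨ +-cong refl (-‿cong (sym (fromℕ-+ a (n ∸ a)))) ⟩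
    (x + y) - fromℕ (a N.+ (n ∸ a))            ≡⟨ ≡.cong (λ k → (x + y) - fromℕ k) (ℕₚ.m+[n∸m]≡n a≤n) ⟩
    (x + y) - fromℕ n                          ∎

  vandermonde : ∀ x y n → ∑[ a ≤ n ] (fromℕ (n C a) * (ff y a * ff x (n ∸ a))) ≈ ff (x + y) n
  vandermonde x y zero = begin
    (1# + 0#) * (1# * 1#)   ≈⟨ *-cong (+-identityʳ _) (*-identityˡ _) ⟩
    1# * 1#                 ≈⟨ *-identityˡ _ ⟩
    1#                      ∎
  vandermonde x y (suc n) = begin
    ∑[ a ≤ suc n ] term (suc n) a                            ≈⟨ sumTo-suc n _ ⟩
    term (suc n) 0 + ∑[ a ≤ n ] term (suc n) (suc a)         ≈⟨ +-cong refl (sumTo-cong n (λ a _ → pascal a)) ⟩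
    term (suc n) 0 + ∑[ a ≤ n ] (raiseY a + raiseX′ a)       ≈⟨ +-cong refl (sumTo-+ raiseY raiseX′ n) ⟩
    term (suc n) 0 + (sumTo n raiseY + sumTo n raiseX′)      ≈⟨ x+[y+z]≈y+[x+z] _ _ _ ⟩
    sumTo n raiseY + (term (suc n) 0 + sumTo n raiseX′)      ≈⟨ +-cong refl shift ⟩
    sumTo n raiseY + sumTo n raiseX                          ≈⟨ sym (sumTo-+ raiseY raiseX n) ⟩
    ∑[ a ≤ n ] (raiseY a + raiseX a)                         ≈⟨ sumTo-cong n factor ⟩
    ∑[ a ≤ n ] (term n a * ((x + y) - fromℕ n))              ≈⟨ sym (sumTo-*ʳ _ (term n) n) ⟩
    sumTo n (term n) * ((x + y) - fromℕ n)                   ≈⟨ *-cong (vandermonde x y n) refl ⟩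
    ff (x + y) (suc n)                                       ∎
    where
    term : ℕ → ℕ → Carrier
    term k a = fromℕ (k C a) * (ff y a * ff x (k ∸ a))
    raiseY raiseX raiseX′ : ℕ → Carrier
    raiseY  a = fromℕ (n C a) * (ff y a * (y - fromℕ a) * ff x (n ∸ a))
    raiseX  a = fromℕ (n C a) * (ff y a * ff x (suc n ∸ a))
    raiseX′ a = fromℕ (n C suc a) * (ff y (suc a) * ff x (n ∸ a))

    x+[y+z]≈y+[x+z] : ∀ u v w → u + (v + w) ≈ v + (u + w)
    x+[y+z]≈y+[x+z] = solve 3 (λ u v w → u :+ (v :+ w) := v :+ (u :+ w)) refl

    pascal : ∀ a → term (suc n) (suc a) ≈ raiseY a + raiseX′ a
    pascal a = begin
      fromℕ (suc n C suc a) * (ff y (suc a) * ff x (n ∸ a))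
        ≡⟨ ≡.cong (λ k → fromℕ k * (ff y (suc a) * ff x (n ∸ a))) (≡.sym (nCk+nC[k+1]≡[n+1]C[k+1] n a)) ⟩
      fromℕ (n C a N.+ n C suc a) * (ff y (suc a) * ff x (n ∸ a))
        ≈⟨ *-cong (fromℕ-+ (n C a) (n C suc a)) refl ⟩
      (fromℕ (n C a) + fromℕ (n C suc a)) * (ff y (suc a) * ff x (n ∸ a))
        ≈⟨ distribʳ _ _ _ ⟩
      raiseY a + raiseX′ a ∎

    shift : term (suc n) 0 + sumTo n raiseX′ ≈ sumTo n raiseX
    shift = begin
      raiseX 0 + sumTo n raiseX′   ≈⟨ sym (sumTo-suc n raiseX) ⟩
      sumTo (suc n) raiseX         ≈⟨ sumTo-truncate raiseX (ℕₚ.n≤1+n n) (λ a n<a _ → n<a⇒raiseX≈0 n<a) ⟩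
      sumTo n raiseX               ∎
      where
      n<a⇒raiseX≈0 : ∀ {a} → n < a → raiseX a ≈ 0#
      n<a⇒raiseX≈0 n<a = trans (*-cong (reflexive (≡.cong fromℕ (k>n⇒nCk≡0 n<a))) refl) (zeroˡ _)

    factor : ∀ a → a ≤ n → raiseY a + raiseX a ≈ term n a * ((x + y) - fromℕ n)
    factor a a≤n = begin
      fromℕ (n C a) * (ff y a * (y - fromℕ a) * ff x (n ∸ a)) + fromℕ (n C a) * (ff y a * ff x (suc n ∸ a))
        ≡⟨ ≡.cong (λ k → raiseY a + fromℕ (n C a) * (ff y a * ff x k)) (ℕₚ.+-∸-assoc 1 a≤n) ⟩
      fromℕ (n C a) * (ff y a * (y - fromℕ a) * ff x (n ∸ a)) + fromℕ (n C a) * (ff y a * (ff x (n ∸ a) * (x - fromℕ (n ∸ a))))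
        ≈⟨ solve 5 (λ c Y X u v → c :* (Y :* u :* X) :+ c :* (Y :* (X :* v)) := c :* (Y :* X) :* (u :+ v)) refl
             (fromℕ (n C a)) (ff y a) (ff x (n ∸ a)) (y - fromℕ a) (x - fromℕ (n ∸ a)) ⟩
      term n a * ((y - fromℕ a) + (x - fromℕ (n ∸ a)))   ≈⟨ *-cong refl (-fromℕ-∸ x y a≤n) ⟩
      term n a * ((x + y) - fromℕ n)                       ∎

  ΠR-++ : ∀ xs ys → ΠR (xs ++ ys) ≈ ΠR xs * ΠR ys
  ΠR-++ []       ys = sym (*-identityˡ _)
  ΠR-++ (x ∷ xs) ys = trans (*-cong refl (ΠR-++ xs ys)) (sym (*-assoc _ _ _))

  fromℕ-prodℕ-* : ∀ {a} {A : Set a} (f : A → ℕ) (g : A → Carrier) xs →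
                  fromℕ (prodℕ (map f xs)) * ΠR (map g xs) ≈ ΠR (map (λ x → fromℕ (f x) * g x) xs)
  fromℕ-prodℕ-* f g []       = trans (*-cong (+-identityʳ _) refl) (*-identityˡ _)
  fromℕ-prodℕ-* f g (x ∷ xs) = begin
    fromℕ (f x N.* prodℕ (map f xs)) * (g x * ΠR (map g xs))           ≈⟨ *-cong (fromℕ-* (f x) _) refl ⟩
    (fromℕ (f x) * fromℕ (prodℕ (map f xs))) * (g x * ΠR (map g xs))   ≈⟨ *-interchange _ _ _ _ ⟩
    (fromℕ (f x) * g x) * (fromℕ (prodℕ (map f xs)) * ΠR (map g xs))   ≈⟨ *-cong refl (fromℕ-prodℕ-* f g xs) ⟩
    ΠR (map (λ x → fromℕ (f x) * g x) (x ∷ xs))                          ∎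
    where
    *-interchange : ∀ w x y z → (w * x) * (y * z) ≈ (w * y) * (x * z)
    *-interchange = solve 4 (λ w x y z → (w :* x) :* (y :* z) := (w :* y) :* (x :* z)) refl

  sumMap-δ : ∀ x j lo c → lo ≤ j → j < lo N.+ c → ∑[ y ∈ range lo c ] [ y N.≟ j ]ᵈ x ≈ x
  sumMap-δ x j lo zero    lo≤j j<lo+0 = ⊥-elim (ℕₚ.<⇒≱ (≡.subst (j <_) (ℕₚ.+-identityʳ lo) j<lo+0) lo≤j)
  sumMap-δ x j lo (suc c) lo≤j j<hi with lo N.≟ j
  ... | yes ≡.refl = trans (+-cong refl rest≈0) (+-identityʳ x)
    where
    rest≈0 : ∑[ y ∈ range (suc lo) c ] [ y N.≟ lo ]ᵈ x ≈ 0#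
    rest≈0 = trans (sumMap-congᴬ (All-range (suc lo) c (λ y lo<y _ → lo<y)) (λ y lo<y → [no]ᵈ (y N.≟ lo) (ℕₚ.>⇒≢ lo<y)))
                   (sumMap-zero (range (suc lo) c) (λ _ → refl))
  ... | no lo≢j = trans (+-cong refl (sumMap-δ x j (suc lo) c (ℕₚ.≤∧≢⇒< lo≤j lo≢j) (≡.subst (j <_) (ℕₚ.+-suc lo c) j<hi)))
                        (+-identityˡ x)

module SumsOverLists {c ℓ : Level} (R : CommutativeRing c ℓ) (m : ℕ) where
  open CommutativeRing R
  open RingSums R
  open import Relation.Binary.Reasoning.Setoid setoid

  InRange : ℕ → Set
  InRange x = 1 ≤ x × x ≤ m

  oneTo-inRange : All InRange (oneTo m)
  oneTo-inRange = ≡.subst (All InRange) (≡.sym (oneTo≡range m)) (All-range 1 m (λ j 1≤j j<1+m → 1≤j , ℕₚ.≤-pred j<1+m))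

  sumAllLists-∷ : ∀ k (F : List ℕ → Carrier) → sumMap F (allLists (suc k) m) ≈ ∑[ x ∈ oneTo m ] ∑[ l ∈ allLists k m ] F (x ∷ l)
  sumAllLists-∷ k F = trans (sumMap-concatMap F _ (oneTo m))
    (sumMap-cong (oneTo m) (λ x → reflexive (sumMap-map F (x ∷_) (allLists k m))))

  sumAllLists-cong : ∀ k {F G : List ℕ → Carrier} → (∀ l → length l ≡ k → All InRange l → F l ≈ G l) →
                     sumMap F (allLists k m) ≈ sumMap G (allLists k m)
  sumAllLists-cong zero    F≈G = +-cong (F≈G [] ≡.refl []) refl
  sumAllLists-cong (suc k) {F} {G} F≈G = begin
    sumMap F (allLists (suc k) m)                    ≈⟨ sumAllLists-∷ k F ⟩
    ∑[ x ∈ oneTo m ] ∑[ l ∈ allLists k m ] F (x ∷ l)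
      ≈⟨ sumMap-congᴬ oneTo-inRange (λ x x∈ → sumAllLists-cong k (λ l len l∈ → F≈G (x ∷ l) (≡.cong suc len) (x∈ ∷ l∈))) ⟩
    ∑[ x ∈ oneTo m ] ∑[ l ∈ allLists k m ] G (x ∷ l) ≈⟨ sym (sumAllLists-∷ k G) ⟩
    sumMap G (allLists (suc k) m)                    ∎

  sumAllLists-∷ʳ : ∀ k (F : List ℕ → Carrier) → sumMap F (allLists (suc k) m) ≈ ∑[ l ∈ allLists k m ] ∑[ y ∈ oneTo m ] F (l ++ [ y ])
  sumAllLists-∷ʳ zero    F = begin
    sumMap F (allLists 1 m)                         ≈⟨ sumAllLists-∷ 0 F ⟩
    ∑[ x ∈ oneTo m ] (F [ x ] + 0#)                 ≈⟨ sumMap-cong (oneTo m) (λ x → +-identityʳ _) ⟩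
    ∑[ x ∈ oneTo m ] F [ x ]                        ≈⟨ sym (+-identityʳ _) ⟩
    ∑[ l ∈ allLists 0 m ] ∑[ y ∈ oneTo m ] F (l ++ [ y ]) ∎
  sumAllLists-∷ʳ (suc k) F = begin
    sumMap F (allLists (suc (suc k)) m)                                          ≈⟨ sumAllLists-∷ (suc k) F ⟩
    ∑[ x ∈ oneTo m ] ∑[ l ∈ allLists (suc k) m ] F (x ∷ l)                       ≈⟨ sumMap-cong (oneTo m) (λ x → sumAllLists-∷ʳ k (F ∘ (x ∷_))) ⟩
    ∑[ x ∈ oneTo m ] ∑[ l ∈ allLists k m ] ∑[ y ∈ oneTo m ] F (x ∷ l ++ [ y ])   ≈⟨ sym (sumAllLists-∷ k _) ⟩
    ∑[ l ∈ allLists (suc k) m ] ∑[ y ∈ oneTo m ] F (l ++ [ y ])                  ∎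

  [sortedWithin-∷ʳ]ᵈ : ∀ i l y (X : ℕ → Carrier) →
    [ sortedWithin? 1 (suc i) (l ++ [ y ]) ]ᵈ X y ≈
    [ sortedWithin? 1 i (l ++ [ y ]) ]ᵈ X y + [ y N.≟ suc i ]ᵈ [ sortedWithin? 1 (suc i) l ]ᵈ X (suc i)
  [sortedWithin-∷ʳ]ᵈ i l y X with y N.≟ suc i
  ... | yes ≡.refl = begin
    [ sortedWithin? 1 (suc i) (l ++ [ suc i ]) ]ᵈ X (suc i)
      ≈⟨ [⇔]ᵈ (sortedWithin? 1 (suc i) (l ++ [ suc i ])) (sortedWithin? 1 (suc i) l)
              (proj₁ ∘ SortedWithin-∷ʳ⁻ 1 (suc i) l (suc i)) (λ sw → SortedWithin-∷ʳ⁺ 1 (suc i) l (suc i) sw (s≤s z≤n) ℕₚ.≤-refl) ⟩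
    [ sortedWithin? 1 (suc i) l ]ᵈ X (suc i)
      ≈⟨ +-identityˡ _ ⟨
    0# + [ sortedWithin? 1 (suc i) l ]ᵈ X (suc i)
      ≈⟨ +-cong ([no]ᵈ (sortedWithin? 1 i (l ++ [ suc i ])) (ℕₚ.1+n≰n ∘ proj₂ ∘ proj₂ ∘ SortedWithin-∷ʳ⁻ 1 i l (suc i))) refl ⟨
    [ sortedWithin? 1 i (l ++ [ suc i ]) ]ᵈ X (suc i) + [ sortedWithin? 1 (suc i) l ]ᵈ X (suc i) ∎
  ... | no y≢1+i = trans ([⇔]ᵈ (sortedWithin? 1 (suc i) (l ++ [ y ])) (sortedWithin? 1 i (l ++ [ y ])) lower raise)
                         (sym (+-identityʳ _))
    where
    lower : SortedWithin 1 (suc i) (l ++ [ y ]) → SortedWithin 1 i (l ++ [ y ])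
    lower sw with SortedWithin-∷ʳ⁻ 1 (suc i) l y sw
    ... | sw′ , 1≤y , y≤1+i = SortedWithin-∷ʳ⁺ 1 i l y sw′ 1≤y (ℕₚ.≤-pred (ℕₚ.≤∧≢⇒< y≤1+i y≢1+i))
    raise : SortedWithin 1 i (l ++ [ y ]) → SortedWithin 1 (suc i) (l ++ [ y ])
    raise sw with SortedWithin-∷ʳ⁻ 1 i l y sw
    ... | sw′ , 1≤y , y≤i = SortedWithin-∷ʳ⁺ 1 (suc i) l y sw′ 1≤y (ℕₚ.m≤n⇒m≤1+n y≤i)

  sumSorted-∷ʳ : ∀ i k (F : List ℕ → Carrier) → suc i ≤ m →
    ∑[ l ∈ allLists (suc k) m ] [ sortedWithin? 1 (suc i) l ]ᵈ F l ≈
    ∑[ l ∈ allLists (suc k) m ] [ sortedWithin? 1 i l ]ᵈ F l + ∑[ l ∈ allLists k m ] [ sortedWithin? 1 (suc i) l ]ᵈ F (l ++ [ suc i ])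
  sumSorted-∷ʳ i k F 1+i≤m = begin
    ∑[ l ∈ allLists (suc k) m ] [ sortedWithin? 1 (suc i) l ]ᵈ F l
      ≈⟨ sumAllLists-∷ʳ k _ ⟩
    ∑[ l ∈ allLists k m ] ∑[ y ∈ oneTo m ] [ sortedWithin? 1 (suc i) (l ++ [ y ]) ]ᵈ F (l ++ [ y ])
      ≈⟨ sumMap-cong (allLists k m) splitLast ⟩
    ∑[ l ∈ allLists k m ] (last≤i l + last≡1+i l)
      ≈⟨ sumMap-+ last≤i last≡1+i (allLists k m) ⟩
    ∑[ l ∈ allLists k m ] last≤i l + ∑[ l ∈ allLists k m ] last≡1+i l
      ≈⟨ +-cong (sym (sumAllLists-∷ʳ k _)) refl ⟩
    ∑[ l ∈ allLists (suc k) m ] [ sortedWithin? 1 i l ]ᵈ F l + ∑[ l ∈ allLists k m ] last≡1+i l ∎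
    where
    last≤i last≡1+i : List ℕ → Carrier
    last≤i   l = ∑[ y ∈ oneTo m ] [ sortedWithin? 1 i (l ++ [ y ]) ]ᵈ F (l ++ [ y ])
    last≡1+i l = [ sortedWithin? 1 (suc i) l ]ᵈ F (l ++ [ suc i ])

    splitLast : ∀ l → ∑[ y ∈ oneTo m ] [ sortedWithin? 1 (suc i) (l ++ [ y ]) ]ᵈ F (l ++ [ y ]) ≈ last≤i l + last≡1+i l
    splitLast l = begin
      _  ≈⟨ sumMap-cong (oneTo m) (λ y → [sortedWithin-∷ʳ]ᵈ i l y (λ y → F (l ++ [ y ]))) ⟩
      _  ≈⟨ sumMap-+ _ _ (oneTo m) ⟩
      _  ≡⟨ ≡.cong (λ ys → last≤i l + ∑[ y ∈ ys ] [ y N.≟ suc i ]ᵈ last≡1+i l) (oneTo≡range m) ⟩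
      _  ≈⟨ +-cong refl (sumMap-δ _ (suc i) 1 m (s≤s z≤n) (s≤s 1+i≤m)) ⟩
      _  ∎

  sumSorted-byMultiplicity : ∀ i k (F : List ℕ → Carrier) → suc i ≤ m →
    ∑[ l ∈ allLists k m ] [ sortedWithin? 1 (suc i) l ]ᵈ F l ≈
    ∑[ a ≤ k ] ∑[ l ∈ allLists (k ∸ a) m ] [ sortedWithin? 1 i l ]ᵈ F (l ++ replicate a (suc i))
  sumSorted-byMultiplicity i zero    F 1+i≤m = refl
  sumSorted-byMultiplicity i (suc k) F 1+i≤m = begin
    ∑[ l ∈ allLists (suc k) m ] [ sortedWithin? 1 (suc i) l ]ᵈ F l
      ≈⟨ sumSorted-∷ʳ i k F 1+i≤m ⟩
    ∑[ l ∈ allLists (suc k) m ] [ sortedWithin? 1 i l ]ᵈ F l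
      + ∑[ l ∈ allLists k m ] [ sortedWithin? 1 (suc i) l ]ᵈ F (l ++ [ suc i ])
      ≈⟨ +-cong (sumMap-cong (allLists (suc k) m) (λ l → reflexive (cong-F l (≡.sym (Listₚ.++-identityʳ l)))))
                (sumSorted-byMultiplicity i k (F ∘ (_++ [ suc i ])) 1+i≤m) ⟩
    g 0 + ∑[ a ≤ k ] ∑[ l ∈ allLists (k ∸ a) m ] [ sortedWithin? 1 i l ]ᵈ F ((l ++ replicate a (suc i)) ++ [ suc i ])
      ≈⟨ +-cong refl (sumTo-cong k (λ a _ → sumMap-cong (allLists (k ∸ a) m) (λ l → reflexive (cong-F l (++-replicate-∷ʳ l a))))) ⟩
    g 0 + ∑[ a ≤ k ] g (suc a)
      ≈⟨ sumTo-suc k g ⟨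
    sumTo (suc k) g ∎
    where
    g : ℕ → Carrier
    g a = ∑[ l ∈ allLists (suc k ∸ a) m ] [ sortedWithin? 1 i l ]ᵈ F (l ++ replicate a (suc i))
    cong-F : ∀ l {l₁ l₂} → l₁ ≡ l₂ → [ sortedWithin? 1 i l ]ᵈ F l₁ ≡ [ sortedWithin? 1 i l ]ᵈ F l₂
    cong-F l = ≡.cong (λ l′ → [ sortedWithin? 1 i l ]ᵈ F l′)
    ++-replicate-∷ʳ : ∀ l a → (l ++ replicate a (suc i)) ++ [ suc i ] ≡ l ++ replicate (suc a) (suc i)
    ++-replicate-∷ʳ l a = ≡.trans (Listₚ.++-assoc l (replicate a (suc i)) [ suc i ]) (≡.cong (l ++_) (replicate-∷ʳ a (suc i)))

module Expansion {c ℓ : Level} (R : CommutativeRing c ℓ) (m : ℕ) (d : CommutativeRing.Carrier R) (s : ℕ → CommutativeRing.Carrier R) where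
  open CommutativeRing R
  open RingDefs R
  open RingSums R
  open SumsOverLists R m
  open Tails m
  open import Algebra.Properties.AbelianGroup +-abelianGroup using (ε⁻¹≈ε)
  open import Algebra.Solver.Ring.NaturalCoefficients.Default commutativeSemiring using (solve; _:+_; _:*_; _:=_)
  open import Relation.Binary.Reasoning.Setoid setoid

  partialSum : ℕ → Carrier
  partialSum i = ΣR (map s (oneTo i))

  factor : ℕ → Carrier
  factor j = (d - fromℕ (j ∸ 1)) + partialSum j

  prefixProduct : ℕ → Carrier
  prefixProduct i = ΠR (map factor (oneTo i))

  shifted : ℕ → Carrier
  shifted i = (d + partialSum i) - fromℕ i

  closedForm : ℕ → ℕ → Carrier
  closedForm i r = prefixProduct i * ff (shifted i) r

  partialSum-suc : ∀ i → partialSum (suc i) ≈ partialSum i + s (suc i)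
  partialSum-suc i = begin
    sumMap s (oneTo (suc i))               ≡⟨ ≡.cong (sumMap s) (oneTo-∷ʳ i) ⟩
    sumMap s (oneTo i ++ [ suc i ])        ≈⟨ sumMap-++ s (oneTo i) [ suc i ] ⟩
    partialSum i + (s (suc i) + 0#)        ≈⟨ +-cong refl (+-identityʳ _) ⟩
    partialSum i + s (suc i)               ∎

  prefixProduct-suc : ∀ i → prefixProduct (suc i) ≈ prefixProduct i * factor (suc i)
  prefixProduct-suc i = begin
    ΠR (map factor (oneTo (suc i)))              ≡⟨ ≡.cong (ΠR ∘ map factor) (oneTo-∷ʳ i) ⟩
    ΠR (map factor (oneTo i ++ [ suc i ]))       ≡⟨ ≡.cong ΠR (Listₚ.map-++ factor (oneTo i) [ suc i ]) ⟩
    ΠR (map factor (oneTo i) ++ [ factor (suc i) ]) ≈⟨ ΠR-++ (map factor (oneTo i)) _ ⟩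
    prefixProduct i * (factor (suc i) * 1#)      ≈⟨ *-cong refl (*-identityʳ _) ⟩
    prefixProduct i * factor (suc i)             ∎

  closedForm-zero : ∀ r → closedForm 0 r ≈ ff d r
  closedForm-zero r = trans (*-identityˡ _) (ff-cong r d+0-0≈d)
    where
    d+0-0≈d : (d + 0#) - 0# ≈ d
    d+0-0≈d = trans (+-cong (+-identityʳ d) ε⁻¹≈ε) (+-identityʳ d)

  closedForm-suc : ∀ i r → closedForm (suc i) r ≈ ∑[ a ≤ suc r ] (fromℕ (suc r C a) * (ff (s (suc i)) a * closedForm i (suc r ∸ a)))
  closedForm-suc i r = begin
    prefixProduct (suc i) * ff (shifted (suc i)) r      ≈⟨ *-cong (prefixProduct-suc i) (ff-cong r (sym shifted-suc)) ⟩
    (prefixProduct i * factor (suc i)) * ff (x + y - 1#) r ≈⟨ *-cong (*-cong refl factor-suc) refl ⟩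
    (prefixProduct i * (x + y)) * ff (x + y - 1#) r     ≈⟨ *-assoc _ _ _ ⟩
    prefixProduct i * ((x + y) * ff (x + y - 1#) r)     ≈⟨ *-cong refl (sym (ff-suc (x + y) r)) ⟩
    prefixProduct i * ff (x + y) (suc r)                ≈⟨ *-cong refl (sym (vandermonde x y (suc r))) ⟩
    prefixProduct i * ∑[ a ≤ suc r ] (fromℕ (suc r C a) * (ff y a * ff x (suc r ∸ a)))
      ≈⟨ sumTo-*ˡ _ _ (suc r) ⟩
    ∑[ a ≤ suc r ] (prefixProduct i * (fromℕ (suc r C a) * (ff y a * ff x (suc r ∸ a))))
      ≈⟨ sumTo-cong (suc r) (λ a _ → regroup (prefixProduct i) (fromℕ (suc r C a)) (ff y a) (ff x (suc r ∸ a))) ⟩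
    ∑[ a ≤ suc r ] (fromℕ (suc r C a) * (ff y a * closedForm i (suc r ∸ a))) ∎
    where
    x y : Carrier
    x = shifted i
    y = s (suc i)
    regroup : ∀ p b f g → p * (b * (f * g)) ≈ b * (f * (p * g))
    regroup = solve 4 (λ p b f g → p :* (b :* (f :* g)) := b :* (f :* (p :* g))) refl
    factor-suc : factor (suc i) ≈ x + y
    factor-suc = begin
      (d - fromℕ i) + partialSum (suc i)        ≈⟨ +-cong refl (partialSum-suc i) ⟩
      (d - fromℕ i) + (partialSum i + y)
        ≈⟨ solve 4 (λ d n S y → (d :+ n) :+ (S :+ y) := ((d :+ S) :+ n) :+ y) refl d (- fromℕ i) (partialSum i) y ⟩
      x + y ∎
    shifted-suc : x + y - 1# ≈ shifted (suc i)
    shifted-suc = begin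
      ((d + partialSum i) - fromℕ i) + y - 1#
        ≈⟨ solve 5 (λ d n S y o → (((d :+ S) :+ n) :+ y) :+ o := (d :+ (S :+ y)) :+ (o :+ n)) refl d (- fromℕ i) (partialSum i) y (- 1#) ⟩
      (d + (partialSum i + y)) + (- 1# + - fromℕ i)
        ≈⟨ +-cong (+-cong refl (sym (partialSum-suc i))) (sym (-‿distrib-+ _ _)) ⟩
      (d + partialSum (suc i)) - (1# + fromℕ i) ∎

  monomial : List ℕ → Carrier
  monomial l = ΠR (map (λ j → ff (s j) (mult j l)) (oneTo m))

  weight : List ℕ → Carrier
  weight l = fromℕ (cm m l) * monomial l

  -- The term of the right-hand side indexed by λ = u, whose n is m ∸ length u.
  summand : List ℕ → Carrier
  summand u = [ boundedFrom? (suc (m ∸ length u)) u ]ᵈ (ff d (m ∸ length u) * weight u)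

  binomialFactor : ℕ → List ℕ → ℕ
  binomialFactor j t = ((m ∸ j N.+ 1) ∸ multAbove m j t) C mult j t

  weightFactor : ℕ → List ℕ → Carrier
  weightFactor j t = fromℕ (binomialFactor j t) * ff (s j) (mult j t)

  -- The factors j > i of c_m(λ) ∏_j (s_j)_{mult_j(λ)}; they only see the entries of λ above i.
  tailWeight : ℕ → List ℕ → Carrier
  tailWeight i t = ΠR (map (λ j → weightFactor j t) (range (suc i) (m ∸ i)))

  weight≈tailWeight : ∀ t → weight t ≈ tailWeight 0 t
  weight≈tailWeight t = begin
    fromℕ (cm m t) * monomial t
      ≡⟨ ≡.cong (λ js → fromℕ (prodℕ (map (λ j → binomialFactor j t) js)) * ΠR (map (λ j → ff (s j) (mult j t)) js)) (oneTo≡range m) ⟩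
    fromℕ (prodℕ (map (λ j → binomialFactor j t) (range 1 m))) * ΠR (map (λ j → ff (s j) (mult j t)) (range 1 m))
      ≈⟨ fromℕ-prodℕ-* _ _ (range 1 m) ⟩
    tailWeight 0 t ∎

  tailWeight-[] : tailWeight m [] ≡ 1#
  tailWeight-[] = ≡.cong (λ k → ΠR (map (λ j → weightFactor j []) (range (suc m) k))) (ℕₚ.n∸n≡0 m)

  tailWeight-replicate : ∀ {i r t} a → Tail (suc i) r t →
    tailWeight i (replicate a (suc i) ++ t) ≈ fromℕ (suc r C a) * ff (s (suc i)) a * tailWeight (suc i) t
  tailWeight-replicate {i} {r} {t} a tail = begin
    ΠR (map (λ j → weightFactor j t′) (range (suc i) (m ∸ i)))
      ≡⟨ ≡.cong (λ k → ΠR (map (λ j → weightFactor j t′) (range (suc i) k))) (ℕₚ.+-∸-assoc 1 i<m) ⟩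
    weightFactor (suc i) t′ * ΠR (map (λ j → weightFactor j t′) (range (suc (suc i)) (m ∸ suc i)))
      ≡⟨ ≡.cong₂ (λ u v → u * ΠR v) head (Listₚ.map-cong-local (All-range (suc (suc i)) (m ∸ suc i) (λ j i<j _ → later j i<j))) ⟩
    fromℕ (suc r C a) * ff (s (suc i)) a * tailWeight (suc i) t ∎
    where
    open Tail tail
    t′ : List ℕ
    t′ = replicate a (suc i) ++ t
    i<m : i < m
    i<m = Tail⇒i≤m tail
    t-within : All (λ x → suc (suc i) ≤ x × x < suc (suc i) N.+ (m ∸ suc i)) t
    t-within = All.map (λ { {x} (i<x , x≤m) → i<x , ≡.subst (x <_) (≡.cong suc (≡.sym (ℕₚ.m+[n∸m]≡n i<m))) (s≤s x≤m) }) above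
    multAbove-t′ : multAbove m (suc i) t′ ≡ length t
    multAbove-t′ = ≡.trans (multAbove≡multIn m (suc i) t′)
      (≡.trans (multIn-replicate-below (suc (suc i)) (m ∸ suc i) a t ℕₚ.≤-refl) (multIn≡length _ _ t t-within))
    mult-t′ : mult (suc i) t′ ≡ a
    mult-t′ = ≡.trans (mult-replicate (suc i) a t)
      (≡.trans (≡.cong (a N.+_) (mult-absent (suc i) t (All.map proj₁ above))) (ℕₚ.+-identityʳ a))
    top : (m ∸ suc i N.+ 1) ∸ multAbove m (suc i) t′ ≡ suc r
    top = ≡.trans (≡.cong₂ (λ n k → (n ∸ suc i N.+ 1) ∸ k) (≡.sym length-≡) multAbove-t′) (∸-binomialTop i r (length t))
    head : weightFactor (suc i) t′ ≡ fromℕ (suc r C a) * ff (s (suc i)) a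
    head = ≡.cong₂ (λ n k → fromℕ (n C k) * ff (s (suc i)) k) top mult-t′
    later : ∀ j → suc i < j → weightFactor j t′ ≡ weightFactor j t
    later j i<j = ≡.cong₂ (λ n k → fromℕ (((m ∸ j N.+ 1) ∸ n) C k) * ff (s j) k)
      (≡.trans (multAbove≡multIn m j t′) (≡.trans (multIn-replicate-below (suc j) (m ∸ j) a t (ℕₚ.m≤n⇒m≤1+n i<j)) (≡.sym (multAbove≡multIn m j t))))
      (mult-replicate-≢ a t (ℕₚ.>⇒≢ i<j))

  prefixSum : ℕ → List ℕ → ℕ → Carrier
  prefixSum i t k = ∑[ l ∈ allLists k m ] [ sortedWithin? 1 i l ]ᵈ summand (l ++ t)

  sumPrefixes : ∀ i r t → Tail i r t → ∑[ k ≤ i N.+ r ] prefixSum i t k ≈ tailWeight i t * closedForm i r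
  sumPrefixes zero r t tail = begin
    ∑[ k ≤ r ] prefixSum 0 t k       ≈⟨ sumTo-truncate (prefixSum 0 t) {0} {r} z≤n (λ { (suc k) _ _ → noPrefix k }) ⟩
    summand t + 0#                   ≈⟨ +-identityʳ _ ⟩
    summand t                        ≈⟨ [yes]ᵈ (boundedFrom? _ t) (≡.subst (λ k → BoundedFrom (suc k) t) (≡.sym m∸t≡r) bounded) ⟩
    ff d (m ∸ length t) * weight t   ≈⟨ *-cong (reflexive (≡.cong (ff d) m∸t≡r)) (weight≈tailWeight t) ⟩
    ff d r * tailWeight 0 t          ≈⟨ *-comm _ _ ⟩
    tailWeight 0 t * ff d r          ≈⟨ *-cong refl (sym (closedForm-zero r)) ⟩
    tailWeight 0 t * closedForm 0 r  ∎
    where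
    open Tail tail
    m∸t≡r : m ∸ length t ≡ r
    m∸t≡r = ≡.trans (≡.cong (_∸ length t) (≡.sym length-≡)) (ℕₚ.m+n∸n≡m r (length t))
    noPrefix : ∀ k → prefixSum 0 t (suc k) ≈ 0#
    noPrefix k = trans (sumAllLists-∷ k _) (sumMap-zero (oneTo m) (λ x → sumMap-zero (allLists k m)
      (λ l → [no]ᵈ (sortedWithin? 1 0 (x ∷ l)) (λ { (s≤s _ , () , _) }))))
  sumPrefixes (suc i) r t tail = begin
    ∑[ k ≤ N ] prefixSum (suc i) t k         ≈⟨ sumTo-cong N (λ k _ → byMultiplicity k) ⟩
    ∑[ k ≤ N ] ∑[ a ≤ k ] W a (k ∸ a)        ≈⟨ sumTo-triangle W N ⟩
    ∑[ a ≤ N ] ∑[ b ≤ N ∸ a ] W a b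
      ≈⟨ sumTo-truncate _ (s≤s (ℕₚ.m≤n+m r i)) (λ a r<a a≤N → sumTo-zero (N ∸ a) (λ b b≤N∸a → overfull a b r<a a≤N b≤N∸a)) ⟩
    ∑[ a ≤ suc r ] ∑[ b ≤ N ∸ a ] W a b      ≈⟨ sumTo-cong (suc r) peel ⟩
    ∑[ a ≤ suc r ] (tailWeight (suc i) t * (fromℕ (suc r C a) * (ff (s (suc i)) a * closedForm i (suc r ∸ a))))
      ≈⟨ sym (sumTo-*ˡ _ _ (suc r)) ⟩
    tailWeight (suc i) t * ∑[ a ≤ suc r ] (fromℕ (suc r C a) * (ff (s (suc i)) a * closedForm i (suc r ∸ a)))
      ≈⟨ *-cong refl (sym (closedForm-suc i r)) ⟩
    tailWeight (suc i) t * closedForm (suc i) r ∎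
    where
    N : ℕ
    N = suc i N.+ r
    W : ℕ → ℕ → Carrier
    W a = prefixSum i (replicate a (suc i) ++ t)

    byMultiplicity : ∀ k → prefixSum (suc i) t k ≈ ∑[ a ≤ k ] W a (k ∸ a)
    byMultiplicity k = trans (sumSorted-byMultiplicity i k (λ u → summand (u ++ t)) (Tail⇒i≤m tail))
      (sumTo-cong k (λ a _ → sumMap-cong (allLists (k ∸ a) m)
        (λ l → reflexive (≡.cong (λ u → [ sortedWithin? 1 i l ]ᵈ summand u) (Listₚ.++-assoc l (replicate a (suc i)) t)))))

    overfull : ∀ a b → suc r < a → a ≤ N → b ≤ N ∸ a → W a b ≈ 0#
    overfull a b r<a a≤N b≤N∸a = trans (sumAllLists-cong b {G = λ _ → 0#} vanishes) (sumMap-zero (allLists b m) (λ _ → refl))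
      where
      vanishes : ∀ l → length l ≡ b → All InRange l → [ sortedWithin? 1 i l ]ᵈ summand (l ++ replicate a (suc i) ++ t) ≈ 0#
      vanishes l ≡.refl _ = [ sortedWithin? 1 i l ]ᵈ-zero ([no]ᵈ (boundedFrom? _ _)
        (Tail-overfull l a tail r<a (ℕₚ.m≤o∸n⇒m+n≤o (length l) a≤N b≤N∸a)))

    peel : ∀ a → a ≤ suc r → ∑[ b ≤ N ∸ a ] W a b ≈ tailWeight (suc i) t * (fromℕ (suc r C a) * (ff (s (suc i)) a * closedForm i (suc r ∸ a)))
    peel a a≤1+r = begin
      ∑[ b ≤ N ∸ a ] W a b                  ≡⟨ ≡.cong (λ n → sumTo n (W a)) N∸a≡i+b ⟩
      ∑[ b ≤ i N.+ (suc r ∸ a) ] W a b      ≈⟨ sumPrefixes i (suc r ∸ a) _ (Tail-replicate tail a≤1+r) ⟩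
      tailWeight i (replicate a (suc i) ++ t) * closedForm i (suc r ∸ a)
        ≈⟨ *-cong (tailWeight-replicate a tail) refl ⟩
      (fromℕ (suc r C a) * ff (s (suc i)) a * tailWeight (suc i) t) * closedForm i (suc r ∸ a)
        ≈⟨ solve 4 (λ b f w g → (b :* f :* w) :* g := w :* (b :* (f :* g))) refl _ _ _ _ ⟩
      tailWeight (suc i) t * (fromℕ (suc r C a) * (ff (s (suc i)) a * closedForm i (suc r ∸ a))) ∎
      where
      N∸a≡i+b : N ∸ a ≡ i N.+ (suc r ∸ a)
      N∸a≡i+b = ≡.trans (≡.cong (_∸ a) (≡.sym (ℕₚ.+-suc i r))) (ℕₚ.+-∸-assoc i a≤1+r)

  rhs-term : ∀ n → n ≤ m → ff d n * sumMap weight (Lset m n) ≈ prefixSum m [] (m ∸ n)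
  rhs-term n n≤m = begin
    ff d n * sumMap weight (filter (isL? m n) (allLists (m ∸ n) m))  ≈⟨ *-cong refl (sumMap-filter (isL? m n) weight (allLists (m ∸ n) m)) ⟩
    ff d n * ∑[ l ∈ allLists (m ∸ n) m ] [ isL? m n l ]ᵈ weight l    ≈⟨ sumMap-*ˡ (ff d n) _ (allLists (m ∸ n) m) ⟩
    ∑[ l ∈ allLists (m ∸ n) m ] (ff d n * [ isL? m n l ]ᵈ weight l)  ≈⟨ sumAllLists-cong (m ∸ n) term ⟩
    prefixSum m [] (m ∸ n)                                           ∎
    where
    term : ∀ l → length l ≡ m ∸ n → All InRange l → ff d n * [ isL? m n l ]ᵈ weight l ≈ [ sortedWithin? 1 m l ]ᵈ summand (l ++ [])
    term l len inRange = begin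
      ff d n * [ isL? m n l ]ᵈ weight l
        ≈⟨ [ isL? m n l ]ᵈ-*ˡ ⟩
      [ isL? m n l ]ᵈ (ff d n * weight l)
        ≈⟨ [×]ᵈ (isL? m n l) (sortedWithin? 1 m l) (boundedFrom? (suc n) l) to from ⟩
      [ sortedWithin? 1 m l ]ᵈ [ boundedFrom? (suc n) l ]ᵈ (ff d n * weight l)
        ≡⟨ ≡.cong (λ k → [ sortedWithin? 1 m l ]ᵈ [ boundedFrom? (suc k) l ]ᵈ (ff d k * weight l)) m∸l≡n ⟨
      [ sortedWithin? 1 m l ]ᵈ summand l
        ≡⟨ ≡.cong (λ u → [ sortedWithin? 1 m l ]ᵈ summand u) (Listₚ.++-identityʳ l) ⟨
      [ sortedWithin? 1 m l ]ᵈ summand (l ++ []) ∎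
      where
      m∸l≡n : m ∸ length l ≡ n
      m∸l≡n = ≡.trans (≡.cong (m ∸_) len) (ℕₚ.m∸[m∸n]≡n n≤m)
      to : IsL m n l → SortedWithin 1 m l × BoundedFrom (suc n) l
      to (_ , sorted , 1≤l , b) = Linked⇒SortedWithin 1 m l (Linked-∷⁺ 1≤l sorted) (All.map proj₂ inRange) , b
      from : SortedWithin 1 m l → BoundedFrom (suc n) l → IsL m n l
      from sw b = len , Linked.tail (SortedWithin⇒Linked 1 m l sw) , SortedWithin⇒≥ 1 m l sw , b

lemma19 : ∀ {c ℓ : Level} (R : CommutativeRing c ℓ) (m : ℕ) (d : CommutativeRing.Carrier R) (s : ℕ → CommutativeRing.Carrier R) →
            CommutativeRing._≈_ R (RingDefs.lhs R m d s) (RingDefs.rhs R m d s)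
lemma19 R m d s = begin
  lhs m d s                                        ≈⟨ *-identityʳ _ ⟨
  closedForm m 0                                   ≈⟨ *-identityˡ _ ⟨
  1# * closedForm m 0                              ≡⟨ ≡.cong (_* closedForm m 0) tailWeight-[] ⟨
  tailWeight m [] * closedForm m 0                 ≈⟨ sumPrefixes m 0 [] Tail-[] ⟨
  ∑[ k ≤ m N.+ 0 ] prefixSum m [] k                ≡⟨ ≡.cong (λ n → sumTo n (prefixSum m [])) (ℕₚ.+-identityʳ m) ⟩
  ∑[ k ≤ m ] prefixSum m [] k                      ≈⟨ sumTo-reverse (prefixSum m []) m ⟨
  ∑[ n ≤ m ] prefixSum m [] (m ∸ n)                ≈⟨ sumTo-cong m rhs-term ⟨
  ∑[ n ≤ m ] (ff d n * sumMap weight (Lset m n))   ≈⟨ sumMap-applyUpTo _ (λ n → n) m ⟨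
  rhs m d s                                        ∎
  where
  open CommutativeRing R
  open RingDefs R
  open RingSums R
  open Tails m
  open Expansion R m d s
  open import Relation.Binary.Reasoning.Setoid setoid
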